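{- Let $\Sigma=\prod_{i=1}^r\Sigma_i\subseteq\mathbb{Z}_p^r$ be a subset which is NRD (resp. SNLD). Then for every positive integer $m$ prime to $p$, the set $m\Sigma:=\prod_{i=1}^r\{m\xi_i\mid \xi_i\in\Sigma_i\}$ is NID (resp. NLD).
   Context: $|\cdot|$ denotes the $p$-adic absolute value on $\mathbb{Z}_p$. An element $\alpha\in\mathbb{Z}_p$ is called $p$-adically non-Liouville if $\liminf_{n\to\infty}|\alpha+n|^{1/n}=\liminf_{n\to\infty}|\alpha-n|^{1/n}=1$. A subset $S\subseteq\mathbb{Z}_p$ is: NID if for all $\alpha,\beta\in S$, $\alpha-\beta$ is not a non-zero integer; NRD if for all $\alpha,\beta\in S$, $\alpha-\beta$ is not a non-zero rational number; NLD if for all $\alpha,\beta\in S$, $\alpha-\beta$ is $p$-adically non-Liouville; SNLD if for all $\alpha,\beta\in S$ and all $a\in\mathbb{Z}_{(p)}$, $\alpha-\beta+a$ is $p$-adically non-Liouville. A product $\Sigma=\prod_{i=1}^r\Sigma_i\subseteq\mathbb{Z}_p^r$ is called NID (resp. NRD, NLD, SNLD) if every $\Sigma_i$ is. -}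

module Defs where

open import Data.Nat as ℕ using (ℕ; suc; _^_)
open import Data.Integer using (ℤ; +_; _+_; _-_; _*_; -_; 0ℤ)
open import Data.Integer.Divisibility.Signed
  using (_∣_; ∣m∣n⇒∣m+n; ∣m⇒∣-m; ∣n⇒∣m*n; ∣-reflexive; ∣-trans)
open import Data.Integer.Properties using (+-inverseʳ)
open import Data.Integer.Solver using (module +-*-Solver)
open import Data.Fin using (Fin)
open import Data.Product using (Σ; ∃; _×_; _,_)
open import Relation.Binary.PropositionalEquality using (_≡_; refl; sym; subst)
open import Relation.Nullary using (¬_)

-- p-adic integers ℤ_p, represented as coherent sequences of integers
-- (a_n)_n with a_{n+1} ≡ a_n (mod p^n); the element is lim a_n.

record ℤₚ (p : ℕ) : Set where
  field
    seq : ℕ → ℤ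
    coh : ∀ n → (+ (p ^ n)) ∣ (seq (suc n) - seq n)
open ℤₚ public

module _ {p : ℕ} where
  open +-*-Solver

  _≈ₚ_ : ℤₚ p → ℤₚ p → Set
  α ≈ₚ β = ∀ n → (+ (p ^ n)) ∣ (seq α n - seq β n)

  ι : ℤ → ℤₚ p
  seq (ι z) _ = z
  coh (ι z) n = subst ((+ (p ^ n)) ∣_) (sym (+-inverseʳ z)) (∣n⇒∣m*n 0ℤ (∣-reflexive refl))

  _+ₚ_ : ℤₚ p → ℤₚ p → ℤₚ p
  seq (α +ₚ β) n = seq α n + seq β n
  coh (α +ₚ β) n =
    subst ((+ (p ^ n)) ∣_)
      (solve 4 (λ a a' b b' → (a' :- a) :+ (b' :- b) := (a' :+ b') :- (a :+ b)) refl
         (seq α n) (seq α (suc n)) (seq β n) (seq β (suc n)))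
      (∣m∣n⇒∣m+n (coh α n) (coh β n))

  -ₚ_ : ℤₚ p → ℤₚ p
  seq (-ₚ α) n = - seq α n
  coh (-ₚ α) n =
    subst ((+ (p ^ n)) ∣_)
      (solve 2 (λ a a' → :- (a' :- a) := (:- a') :- (:- a)) refl (seq α n) (seq α (suc n)))
      (∣m⇒∣-m (coh α n))

  _-ₚ_ : ℤₚ p → ℤₚ p → ℤₚ p
  α -ₚ β = α +ₚ (-ₚ β)

  _·ₚ_ : ℤ → ℤₚ p → ℤₚ p
  seq (z ·ₚ α) n = z * seq α n
  coh (z ·ₚ α) n =
    subst ((+ (p ^ n)) ∣_)
      (solve 3 (λ c a a' → c :* (a' :- a) := (c :* a') :- (c :* a)) refl z (seq α n) (seq α (suc n)))
      (∣n⇒∣m*n z (coh α n))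

  -- p^j divides α in ℤ_p, i.e. v_p(α) ≥ j, i.e. |α| ≤ p^{-j}
  _∣ₚ_ : ℕ → ℤₚ p → Set
  j ∣ₚ α = (+ (p ^ j)) ∣ seq α j

-- For x ∈ ℤ_p, |x|^{1/n} = p^{-v(x)/n} ≤ 1, so
--   liminf_n |α ± n|^{1/n} = 1  ⟺  ∀ k ≥ 1, eventually v(α ± n) < n/k,
-- and v(x) < n/k ⟺ there is no j with p^j ∣ x and n ≤ k·j.

LiminfAbsRootIsOne : (p : ℕ) → (ℕ → ℤₚ p) → Set
LiminfAbsRootIsOne p x =
  ∀ (k : ℕ) → ∃ λ N → ∀ n → N ℕ.≤ n →
    ∀ j → n ℕ.≤ suc k ℕ.* j → ¬ (j ∣ₚ x n)

NonLiouville : (p : ℕ) → ℤₚ p → Set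
NonLiouville p α =
  LiminfAbsRootIsOne p (λ n → α +ₚ ι (+ n)) ×
  LiminfAbsRootIsOne p (λ n → α -ₚ ι (+ n))

Subset : ℕ → Set₁
Subset p = ℤₚ p → Set

IsNonZeroInt : (p : ℕ) → ℤₚ p → Set
IsNonZeroInt p x = ∃ λ (z : ℤ) → ¬ (z ≡ 0ℤ) × (x ≈ₚ ι z)

IsNonZeroRat : (p : ℕ) → ℤₚ p → Set
IsNonZeroRat p x = ∃ λ (u : ℤ) → ∃ λ (v : ℤ) →
  ¬ (u ≡ 0ℤ) × ¬ (v ≡ 0ℤ) × ((v ·ₚ x) ≈ₚ ι u)

-- a ∈ ℤ_(p) ⊆ ℤ_p : a = u/v with u, v ∈ ℤ, p ∤ v
InZp-loc : (p : ℕ) → ℤₚ p → Set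
InZp-loc p a = ∃ λ (u : ℤ) → ∃ λ (v : ℤ) →
  ¬ ((+ p) ∣ v) × ((v ·ₚ a) ≈ₚ ι u)

NID : (p : ℕ) → Subset p → Set
NID p S = ∀ α β → S α → S β → ¬ IsNonZeroInt p (α -ₚ β)

NRD : (p : ℕ) → Subset p → Set
NRD p S = ∀ α β → S α → S β → ¬ IsNonZeroRat p (α -ₚ β)

NLD : (p : ℕ) → Subset p → Set
NLD p S = ∀ α β → S α → S β → NonLiouville p (α -ₚ β)

SNLD : (p : ℕ) → Subset p → Set
SNLD p S = ∀ α β → S α → S β → ∀ a → InZp-loc p a →
  NonLiouville p ((α -ₚ β) +ₚ a)

Product : ℕ → ℕ → Set₁
Product p r = Fin r → Subset p

ProdNID ProdNRD ProdNLD ProdSNLD : ∀ {p r} → Product p r → Set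
ProdNID  {p} Σ' = ∀ i → NID  p (Σ' i)
ProdNRD  {p} Σ' = ∀ i → NRD  p (Σ' i)
ProdNLD  {p} Σ' = ∀ i → NLD  p (Σ' i)
ProdSNLD {p} Σ' = ∀ i → SNLD p (Σ' i)

scaleSet : ∀ {p} → ℕ → Subset p → Subset p
scaleSet m S x = ∃ λ ξ → S ξ × (x ≈ₚ ((+ m) ·ₚ ξ))

scaleProd : ∀ {p r} → ℕ → Product p r → Product p r
scaleProd m Σ' i = scaleSet m (Σ' i)

{-# OPTIONS --safe #-}
-- If mξ − mη is a non-zero integer z, then ξ − η is the non-zero rational
-- z/m. For the Liouville part write n = s + q m with 0 ≤ s < m: then
-- mξ − mη + n = m (ξ − η + s/m + q), and since m is a p-adic unit,
-- v(mξ − mη + n) = v(ξ − η + s/m + q). As s/m ∈ ℤ_(p), the strong hypothesis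
-- makes this valuation smaller than q/k ≤ n/k for q large, uniformly in the
-- finitely many residues s. The case mξ − mη − n is the same argument
-- applied to mη − mξ + n.
module Submission where

open import Defs
open import Data.Nat using (ℕ; NonZero)
open import Data.Nat.Primality using (Prime)
open import Data.Nat.Coprimality using (Coprime)
open import Data.Product using (_×_)

open import Level using (0ℓ)
open import Data.Nat as ℕ using (suc; _<_; _≤_; _⊔_; _%_; _/_)
open import Data.Nat.Properties
  using (≤-trans; m<1+n⇒m<n∨m≡n; m≤n⇒m≤n⊔o; m≤n⊔m; *-comm)
open import Data.Nat.DivMod using (m≡m%n+[m/n]*n; m%n<n; m/n≤m; /-monoˡ-≤; m*n/n≡m)
import Data.Nat.Divisibility as ℕ
import Data.Nat.Coprimality as ℕ
open import Data.Nat.GCD using (module Bézout)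
open import Data.Nat.Primality using (¬prime[1])
open import Data.Integer using (ℤ; +_; _+_; _-_; _*_; -_; 0ℤ; 1ℤ; ∣_∣)
open import Data.Integer.Properties using (pos-+; pos-*; neg-involutive)
import Data.Integer.Coprimality as ℤ
open import Data.Integer.Divisibility.Signed
  using (_∣_; divides; ∣ᵤ⇒∣; ∣⇒∣ᵤ; ∣m∣n⇒∣m+n; ∣m⇒∣-m; ∣n⇒∣m*n; ∣m∣n⇒∣m-n; ∣-trans)
open import Data.Integer.Solver using (module +-*-Solver)
open import Data.Wrap using (Wrap; [_]; get)
open import Data.Product using (∃; _,_; proj₁; proj₂)
open import Data.Sum using (inj₁; inj₂)
open import Relation.Binary.Bundles using (Setoid)
import Relation.Binary.Reasoning.Setoid as ≃-Reasoning
open import Relation.Binary.PropositionalEquality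
  using (_≡_; refl; sym; trans; cong; subst; module ≡-Reasoning)
open import Relation.Nullary using (¬_)
open +-*-Solver

coprime-* : ∀ {m a b} → Coprime m a → Coprime m b → Coprime m (a ℕ.* b)
coprime-* m⊥a m⊥b (d∣m , d∣ab) =
  m⊥b (d∣m , ℕ.coprime-divisor (λ (e∣d , e∣a) → m⊥a (ℕ.∣-trans e∣d d∣m , e∣a)) d∣ab)

coprime-^ : ∀ {m a} → Coprime m a → ∀ j → Coprime m (a ℕ.^ j)
coprime-^ m⊥a ℕ.zero    (_ , d∣1) = ℕ.∣1⇒≡1 d∣1
coprime-^ m⊥a (suc j) = coprime-* m⊥a (coprime-^ m⊥a j)

prime∧coprime⇒∤ : ∀ {m p} → Prime p → Coprime m p → ¬ (p ℕ.∣ m)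
prime∧coprime⇒∤ p-prime m⊥p p∣m = ¬prime[1] (subst Prime (m⊥p (p∣m , ℕ.∣-refl)) p-prime)

coprime-cancel : ∀ {m q} w → Coprime m q → + q ∣ + m * w → + q ∣ w
coprime-cancel w m⊥q q∣mw = ∣ᵤ⇒∣ (ℤ.coprime-divisor (+ _) (+ _) w (ℕ.sym m⊥q) (∣⇒∣ᵤ q∣mw))

1+*≡*⇒ℤ : ∀ b c d e → 1 ℕ.+ b ℕ.* c ≡ d ℕ.* e → 1ℤ + + b * + c ≡ + d * + e
1+*≡*⇒ℤ b c d e eq =
  trans (cong (λ t → 1ℤ + t) (sym (pos-* b c))) (trans (cong +_ eq) (pos-* d e))

modular-inverse : ∀ {m q} → Coprime m q → ∃ λ b → + q ∣ + m * b - 1ℤ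
modular-inverse {m} {q} m⊥q with ℕ.coprime-Bézout m⊥q
... | Bézout.+- x y eq = + x , divides (+ y) (begin
  + m * + x - 1ℤ      ≡⟨ solve 2 (λ m x → m :* x :- con 1ℤ := x :* m :- con 1ℤ) refl (+ m) (+ x) ⟩
  + x * + m - 1ℤ      ≡⟨ cong (_- 1ℤ) (1+*≡*⇒ℤ y q x m eq) ⟨
  1ℤ + + y * + q - 1ℤ ≡⟨ solve 2 (λ y q → con 1ℤ :+ y :* q :- con 1ℤ := y :* q) refl (+ y) (+ q) ⟩
  + y * + q           ∎)
  where open ≡-Reasoning
... | Bézout.-+ x y eq = - + x , divides (- + y) (begin
  + m * - + x - 1ℤ    ≡⟨ solve 2 (λ m x → m :* (:- x) :- con 1ℤ := :- (con 1ℤ :+ x :* m)) refl (+ m) (+ x) ⟩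
  - (1ℤ + + x * + m)  ≡⟨ cong -_ (1+*≡*⇒ℤ x m y q eq) ⟩
  - (+ y * + q)       ≡⟨ solve 2 (λ y q → :- (y :* q) := (:- y) :* q) refl (+ y) (+ q) ⟩
  - + y * + q         ∎)
  where open ≡-Reasoning

-- _≈ₚ_ unfolds to a Π-type, from which Agda cannot recover the two related
-- elements; wrapping it makes them inferable.
_≃ₚ_ : ∀ {p} → ℤₚ p → ℤₚ p → Set
_≃ₚ_ = Wrap _≈ₚ_

infix 4 _≃ₚ_

module _ {p : ℕ} where

  private
    P : ℕ → ℤ
    P n = + (p ℕ.^ n)

  ≃ₚ-refl : {α : ℤₚ p} → α ≃ₚ α
  ≃ₚ-refl {α} = [ (λ n → divides 0ℤ (solve 1 (λ a → a :- a := con 0ℤ) refl (seq α n))) ]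

  ≃ₚ-sym : {α β : ℤₚ p} → α ≃ₚ β → β ≃ₚ α
  ≃ₚ-sym {α} {β} [ α≈β ] = [ (λ n →
    subst (P n ∣_) (solve 2 (λ a b → :- (a :- b) := b :- a) refl (seq α n) (seq β n))
      (∣m⇒∣-m (α≈β n))) ]

  ≃ₚ-trans : {α β γ : ℤₚ p} → α ≃ₚ β → β ≃ₚ γ → α ≃ₚ γ
  ≃ₚ-trans {α} {β} {γ} [ α≈β ] [ β≈γ ] = [ (λ n →
    subst (P n ∣_) (solve 3 (λ a b c → (a :- b) :+ (b :- c) := a :- c) refl (seq α n) (seq β n) (seq γ n))
      (∣m∣n⇒∣m+n (α≈β n) (β≈γ n))) ]

  ℤₚ-setoid : Setoid 0ℓ 0ℓ
  ℤₚ-setoid = record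
    { Carrier       = ℤₚ p
    ; _≈_           = _≃ₚ_
    ; isEquivalence = record { refl = ≃ₚ-refl ; sym = ≃ₚ-sym ; trans = ≃ₚ-trans }
    }

  ≃ₚ-pointwise : {α β : ℤₚ p} → (∀ n → seq α n ≡ seq β n) → α ≃ₚ β
  ≃ₚ-pointwise {α} α≡β = [ (λ n → subst (λ b → P n ∣ seq α n - b) (α≡β n) (get (≃ₚ-refl {α}) n)) ]

  +ₚ-cong : {α α′ β β′ : ℤₚ p} → α ≃ₚ α′ → β ≃ₚ β′ → α +ₚ β ≃ₚ α′ +ₚ β′
  +ₚ-cong {α} {α′} {β} {β′} [ α≈α′ ] [ β≈β′ ] = [ (λ n →
    subst (P n ∣_)
      (solve 4 (λ a a′ b b′ → (a :- a′) :+ (b :- b′) := (a :+ b) :- (a′ :+ b′)) refl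
        (seq α n) (seq α′ n) (seq β n) (seq β′ n))
      (∣m∣n⇒∣m+n (α≈α′ n) (β≈β′ n))) ]

  -ₚ-cong : {α α′ : ℤₚ p} → α ≃ₚ α′ → -ₚ α ≃ₚ -ₚ α′
  -ₚ-cong {α} {α′} [ α≈α′ ] = [ (λ n →
    subst (P n ∣_) (solve 2 (λ a a′ → :- (a :- a′) := (:- a) :- (:- a′)) refl (seq α n) (seq α′ n))
      (∣m⇒∣-m (α≈α′ n))) ]

  ·ₚ-congˡ : ∀ z {α α′ : ℤₚ p} → α ≃ₚ α′ → z ·ₚ α ≃ₚ z ·ₚ α′
  ·ₚ-congˡ z {α} {α′} [ α≈α′ ] = [ (λ n →
    subst (P n ∣_) (solve 3 (λ z a a′ → z :* (a :- a′) := z :* a :- z :* a′) refl z (seq α n) (seq α′ n))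
      (∣n⇒∣m*n z (α≈α′ n))) ]

  +ₚ-assoc : (α β γ : ℤₚ p) → (α +ₚ β) +ₚ γ ≃ₚ α +ₚ (β +ₚ γ)
  +ₚ-assoc α β γ = ≃ₚ-pointwise λ n →
    solve 3 (λ a b c → (a :+ b) :+ c := a :+ (b :+ c)) refl (seq α n) (seq β n) (seq γ n)

  ·ₚ-distribˡ-+ₚ : ∀ z (α β : ℤₚ p) → z ·ₚ (α +ₚ β) ≃ₚ (z ·ₚ α) +ₚ (z ·ₚ β)
  ·ₚ-distribˡ-+ₚ z α β = ≃ₚ-pointwise λ n →
    solve 3 (λ z a b → z :* (a :+ b) := z :* a :+ z :* b) refl z (seq α n) (seq β n)

  ·ₚ-distribˡ--ₚ : ∀ z (α β : ℤₚ p) → z ·ₚ (α -ₚ β) ≃ₚ (z ·ₚ α) -ₚ (z ·ₚ β)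
  ·ₚ-distribˡ--ₚ z α β = ≃ₚ-pointwise λ n →
    solve 3 (λ z a b → z :* (a :- b) := z :* a :- z :* b) refl z (seq α n) (seq β n)

  α-β-γ≃-[β-α+γ] : (α β γ : ℤₚ p) → (α -ₚ β) -ₚ γ ≃ₚ -ₚ ((β -ₚ α) +ₚ γ)
  α-β-γ≃-[β-α+γ] α β γ = ≃ₚ-pointwise λ n →
    solve 3 (λ a b c → (a :- b) :- c := :- ((b :- a) :+ c)) refl (seq α n) (seq β n) (seq γ n)

  ∣ₚ-resp-≃ₚ : ∀ j {α β : ℤₚ p} → α ≃ₚ β → j ∣ₚ α → j ∣ₚ β
  ∣ₚ-resp-≃ₚ j {α} {β} [ α≈β ] j∣α =
    subst (P j ∣_) (solve 2 (λ a b → a :- (a :- b) := b) refl (seq α j) (seq β j))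
      (∣m∣n⇒∣m-n j∣α (α≈β j))

  ∣ₚ-neg : ∀ j (α : ℤₚ p) → j ∣ₚ (-ₚ α) → j ∣ₚ α
  ∣ₚ-neg j α j∣-α = subst (P j ∣_) (neg-involutive (seq α j)) (∣m⇒∣-m j∣-α)

  ∣ₚ-cancel-coprime : ∀ {m} → Coprime m p → ∀ j (α : ℤₚ p) → j ∣ₚ ((+ m) ·ₚ α) → j ∣ₚ α
  ∣ₚ-cancel-coprime m⊥p j α = coprime-cancel (seq α j) (coprime-^ m⊥p j)

scaled-difference : ∀ {p} z (x y ξ η : ℤₚ p) → x ≃ₚ z ·ₚ ξ → y ≃ₚ z ·ₚ η → x -ₚ y ≃ₚ z ·ₚ (ξ -ₚ η)
scaled-difference {p} z x y ξ η x≃zξ y≃zη = begin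
  x -ₚ y                  ≈⟨ +ₚ-cong x≃zξ (-ₚ-cong y≃zη) ⟩
  (z ·ₚ ξ) -ₚ (z ·ₚ η)    ≈⟨ ·ₚ-distribˡ--ₚ z ξ η ⟨
  z ·ₚ (ξ -ₚ η)           ∎
  where open ≃-Reasoning (ℤₚ-setoid {p})

+-divMod : ∀ m .{{_ : NonZero m}} n → + n ≡ + (n % m) + + m * + (n / m)
+-divMod m n = begin
  + n                              ≡⟨ cong +_ (m≡m%n+[m/n]*n n m) ⟩
  + (n % m ℕ.+ n / m ℕ.* m)        ≡⟨ pos-+ (n % m) (n / m ℕ.* m) ⟩
  + (n % m) + + (n / m ℕ.* m)      ≡⟨ cong (λ t → + (n % m) + + t) (*-comm (n / m) m) ⟩
  + (n % m) + + (m ℕ.* (n / m))    ≡⟨ cong (λ t → + (n % m) + t) (pos-* m (n / m)) ⟩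
  + (n % m) + + m * + (n / m)      ∎
  where open ≡-Reasoning

bounded-on-range : (f : ℕ → ℕ) (m : ℕ) → ∃ λ M → ∀ {s} → s < m → f s ≤ M
bounded-on-range f ℕ.zero = 0 , λ ()
bounded-on-range f (suc m) with M , f≤M ← bounded-on-range f m = M ⊔ f m , f≤M⊔fm
  where
    f≤M⊔fm : ∀ {s} → s < suc m → f s ≤ M ⊔ f m
    f≤M⊔fm s<1+m with m<1+n⇒m<n∨m≡n s<1+m
    ... | inj₁ s<m  = m≤n⇒m≤n⊔o (f m) (f≤M s<m)
    ... | inj₂ refl = m≤n⊔m M (f m)

LiminfAbsRootIsOne-mono : ∀ {p} (x y : ℕ → ℤₚ p) →
  (∀ n j → j ∣ₚ x n → j ∣ₚ y n) → LiminfAbsRootIsOne p y → LiminfAbsRootIsOne p x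
LiminfAbsRootIsOne-mono x y x⇒y liminf-y k with N , small ← liminf-y k =
  N , λ n N≤n j n≤kj j∣x → small n N≤n j n≤kj (x⇒y n j j∣x)

-- The threshold for x is m times the largest threshold of the m families y s.
LiminfAbsRootIsOne-residues : ∀ {p} m .{{_ : NonZero m}} (x : ℕ → ℤₚ p) (y : ℕ → ℕ → ℤₚ p) →
  (∀ s → LiminfAbsRootIsOne p (y s)) → (∀ n j → j ∣ₚ x n → j ∣ₚ y (n % m) (n / m)) →
  LiminfAbsRootIsOne p x
LiminfAbsRootIsOne-residues m x y liminf-y x⇒y k = M ℕ.* m , small
  where
    N : ℕ → ℕ
    N s = proj₁ (liminf-y s k)

    M : ℕ
    M = proj₁ (bounded-on-range N m)

    N≤M : ∀ {s} → s < m → N s ≤ M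
    N≤M = proj₂ (bounded-on-range N m)

    small : ∀ n → M ℕ.* m ≤ n → ∀ j → n ≤ suc k ℕ.* j → ¬ (j ∣ₚ x n)
    small n Mm≤n j n≤kj j∣x =
      proj₂ (liminf-y (n % m) k) (n / m) N≤n/m j (≤-trans (m/n≤m n m) n≤kj) (x⇒y n j j∣x)
      where
        N≤n/m : N (n % m) ≤ n / m
        N≤n/m = ≤-trans (N≤M (m%n<n n m)) (subst (_≤ n / m) (m*n/n≡m M m) (/-monoˡ-≤ m Mm≤n))

scale-NRD⇒NID : ∀ {p} m .{{_ : NonZero m}} {S : Subset p} → NRD p S → NID p (scaleSet m S)
scale-NRD⇒NID m nrd x y (ξ , ξ∈S , x≈mξ) (η , η∈S , y≈mη) (z , z≢0 , x-y≈z) =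
  nrd ξ η ξ∈S η∈S (z , + m , z≢0 , +m≢0 , get mδ≃z)
  where
    mδ≃z : (+ m) ·ₚ (ξ -ₚ η) ≃ₚ ι z
    mδ≃z = begin
      (+ m) ·ₚ (ξ -ₚ η)  ≈⟨ scaled-difference (+ m) x y ξ η [ x≈mξ ] [ y≈mη ] ⟨
      x -ₚ y             ≈⟨ [ x-y≈z ] ⟩
      ι z                ∎
      where open ≃-Reasoning ℤₚ-setoid

    +m≢0 : ¬ (+ m ≡ 0ℤ)
    +m≢0 eq = ℕ.≢-nonZero⁻¹ m (cong ∣_∣ eq)

module _ {p m : ℕ} (m⊥p : Coprime m p) where

  private
    P : ℕ → ℤ
    P n = + (p ℕ.^ n)

    m⊥pⁿ : ∀ n → Coprime m (p ℕ.^ n)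
    m⊥pⁿ = coprime-^ m⊥p

    inverse : ℕ → ℤ
    inverse n = proj₁ (modular-inverse (m⊥pⁿ n))

    m*inverse-1 : ∀ n → P n ∣ + m * inverse n - 1ℤ
    m*inverse-1 n = proj₂ (modular-inverse (m⊥pⁿ n))

    inverse-coherent : ∀ n → P n ∣ inverse (suc n) - inverse n
    inverse-coherent n = coprime-cancel _ (m⊥pⁿ n)
      (subst (P n ∣_)
        (solve 3 (λ m b′ b → (m :* b′ :- con 1ℤ) :- (m :* b :- con 1ℤ) := m :* (b′ :- b)) refl
          (+ m) (inverse (suc n)) (inverse n))
        (∣m∣n⇒∣m-n (∣-trans (∣ᵤ⇒∣ (ℕ.n∣m*n p)) (m*inverse-1 (suc n))) (m*inverse-1 n)))

  -- s/m, as the coherent sequence of s · m⁻¹ mod pⁿ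
  fraction : ℤ → ℤₚ p
  seq (fraction s) n = s * inverse n
  coh (fraction s) n =
    subst (P n ∣_) (solve 3 (λ s b′ b → s :* (b′ :- b) := s :* b′ :- s :* b) refl s (inverse (suc n)) (inverse n))
      (∣n⇒∣m*n s (inverse-coherent n))

  ·ₚ-fraction : ∀ s → (+ m) ·ₚ fraction s ≃ₚ ι s
  ·ₚ-fraction s = [ (λ n →
    subst (P n ∣_) (solve 3 (λ s m b → s :* (m :* b :- con 1ℤ) := m :* (s :* b) :- s) refl s (+ m) (inverse n))
      (∣n⇒∣m*n s (m*inverse-1 n))) ]

  fraction-local : Prime p → ∀ s → InZp-loc p (fraction s)
  fraction-local p-prime s =
    s , + m , (λ p∣m → prime∧coprime⇒∤ p-prime m⊥p (∣⇒∣ᵤ p∣m)) , get (·ₚ-fraction s)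

  ι-divMod : .{{_ : NonZero m}} → ∀ n →
    ι (+ n) ≃ₚ (+ m) ·ₚ (fraction (+ (n % m)) +ₚ ι (+ (n / m)))
  ι-divMod n = begin
    ι (+ n)
      ≈⟨ ≃ₚ-pointwise (λ _ → +-divMod m n) ⟩
    ι (+ (n % m)) +ₚ ((+ m) ·ₚ ι (+ (n / m)))
      ≈⟨ +ₚ-cong (·ₚ-fraction (+ (n % m))) ≃ₚ-refl ⟨
    ((+ m) ·ₚ fraction (+ (n % m))) +ₚ ((+ m) ·ₚ ι (+ (n / m)))
      ≈⟨ ·ₚ-distribˡ-+ₚ (+ m) (fraction (+ (n % m))) (ι (+ (n / m))) ⟨
    (+ m) ·ₚ (fraction (+ (n % m)) +ₚ ι (+ (n / m)))
      ∎
    where open ≃-Reasoning (ℤₚ-setoid {p})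

  -- Nested here so that `fraction` is always applied to the same m⊥p: for
  -- syntactically different copies Agda compares ℤₚ terms field by field,
  -- unfolding the ring-solver proofs in `coh`, which is prohibitively slow.
  module _ (p-prime : Prime p) .{{_ : NonZero m}} {S : Subset p} (snld : SNLD p S) where

    LiminfAbsRootIsOne-scaled-difference : ∀ x y → scaleSet m S x → scaleSet m S y →
      LiminfAbsRootIsOne p (λ n → (x -ₚ y) +ₚ ι (+ n))
    LiminfAbsRootIsOne-scaled-difference x y (ξ , ξ∈S , x≈mξ) (η , η∈S , y≈mη) =
      LiminfAbsRootIsOne-residues m (λ n → (x -ₚ y) +ₚ ι (+ n))
        (λ s q → ((ξ -ₚ η) +ₚ fraction (+ s)) +ₚ ι (+ q))
        (λ s → proj₁ (snld ξ η ξ∈S η∈S (fraction (+ s)) (fraction-local p-prime (+ s))))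
        (λ n j j∣x-y+n → ∣ₚ-cancel-coprime m⊥p j (((ξ -ₚ η) +ₚ fraction (+ (n % m))) +ₚ ι (+ (n / m)))
                           (∣ₚ-resp-≃ₚ j (x-y+n≃m[ξ-η+s/m+q] n) j∣x-y+n))
      where
        open ≃-Reasoning (ℤₚ-setoid {p})

        x-y+n≃m[ξ-η+s/m+q] : ∀ n → (x -ₚ y) +ₚ ι (+ n) ≃ₚ
          (+ m) ·ₚ (((ξ -ₚ η) +ₚ fraction (+ (n % m))) +ₚ ι (+ (n / m)))
        x-y+n≃m[ξ-η+s/m+q] n = begin
          (x -ₚ y) +ₚ ι (+ n)
            ≈⟨ +ₚ-cong (scaled-difference (+ m) x y ξ η [ x≈mξ ] [ y≈mη ]) (ι-divMod n) ⟩
          ((+ m) ·ₚ (ξ -ₚ η)) +ₚ ((+ m) ·ₚ (fraction (+ (n % m)) +ₚ ι (+ (n / m))))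
            ≈⟨ ·ₚ-distribˡ-+ₚ (+ m) (ξ -ₚ η) (fraction (+ (n % m)) +ₚ ι (+ (n / m))) ⟨
          (+ m) ·ₚ ((ξ -ₚ η) +ₚ (fraction (+ (n % m)) +ₚ ι (+ (n / m))))
            ≈⟨ ·ₚ-congˡ (+ m) (+ₚ-assoc (ξ -ₚ η) (fraction (+ (n % m))) (ι (+ (n / m)))) ⟨
          (+ m) ·ₚ (((ξ -ₚ η) +ₚ fraction (+ (n % m))) +ₚ ι (+ (n / m)))
            ∎

    scale-SNLD⇒NLD : NLD p (scaleSet m S)
    scale-SNLD⇒NLD x y x∈mS y∈mS =
      LiminfAbsRootIsOne-scaled-difference x y x∈mS y∈mS ,
      LiminfAbsRootIsOne-mono (λ n → (x -ₚ y) -ₚ ι (+ n)) (λ n → (y -ₚ x) +ₚ ι (+ n))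
        (λ n j j∣x-y-n → ∣ₚ-neg j ((y -ₚ x) +ₚ ι (+ n)) (∣ₚ-resp-≃ₚ j (α-β-γ≃-[β-α+γ] x y (ι (+ n))) j∣x-y-n))
        (LiminfAbsRootIsOne-scaled-difference y x y∈mS x∈mS)

lemma1p4 : (p : ℕ) → Prime p → (r : ℕ) → (Σ' : Product p r) →
    ((ProdNRD Σ' → ∀ (m : ℕ) → NonZero m → Coprime m p → ProdNID (scaleProd m Σ')) ×
    (ProdSNLD Σ' → ∀ (m : ℕ) → NonZero m → Coprime m p → ProdNLD (scaleProd m Σ')))
lemma1p4 p p-prime r Σ' =
  (λ nrd m m≢0 _ i → scale-NRD⇒NID m {{m≢0}} (nrd i)) ,
  (λ snld m m≢0 m⊥p i → scale-SNLD⇒NLD m⊥p p-prime {{m≢0}} (snld i))
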